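{- Let $q\subseteq\{1,\dots,n\}$ be a queue and let $u\in\mathcal W_n$ be a word with $\ell$ classes. Then $q(u)_i=\ell+2-q^*(u^*)_{n+1-i}$ for all $i\in\{1,\dots,n\}$; that is, $(q(u))^*=q^*(u^*)$ when $q(u)$ is regarded as a word with $\ell+1$ classes.
   Context: Fix $n\ge1$; sites $1,\dots,n$ arranged cyclically. $\mathcal{W}_n$ is the set of words $u=u_1\cdots u_n$ with letters in $\{1,2,\dots\}$; the number of classes of $u$ is its largest letter. For a queue $q$ and $u$, $v=q(u)$ is defined by: choose a permutation $(i_1,\dots,i_n)$ of $(1,\dots,n)$ with $u_{i_1}\le\cdots\le u_{i_n}$; Phase I: for $i=i_n,\dots,i_{|q|+1}$ in order, take the first site $j$ weakly to the left of $i$ (cyclically) with $j\notin q$ and $v_j$ unset, set $v_j=u_i+1$; Phase II: for $i=i_1,\dots,i_{|q|}$ in order, take the first site $j$ weakly to the right of $i$ (cyclically) with $j\in q$ and $v_j$ unset, set $v_j=u_i$. The contragredient dual queue is $q^*=\{i: n+1-i\notin q\}$. For a word $w$ regarded as having $L$ classes, its contragredient dual is $w^*$ with $w^*_i=L+1-w_{n+1-i}$. -}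

module Defs where

open import Data.Nat using (ℕ; zero; suc; _+_; _∸_; _≤_; _⊔_; NonZero)
open import Data.Nat.DivMod using (_%_; m%n<n)
open import Data.Bool using (Bool; true; false; not; _∧_)
open import Data.Fin using (Fin; toℕ; fromℕ<; opposite)
import Data.Fin as F
open import Data.Fin.Subset using (Subset; ∣_∣)
open import Data.Fin.Permutation using (Permutation′; _⟨$⟩ʳ_)
open import Data.Vec using (lookup; tabulate)
open import Data.List using (List; []; _∷_; map; upTo; allFin; reverse; take; drop; foldl; foldr)
open import Data.Maybe using (Maybe; just; nothing; fromMaybe)
open import Relation.Nullary using (does)

-- Sites 1..n are represented by Fin n (site k ↦ index k-1).
-- A word is an assignment of a letter (a natural number) to every site.
Word : ℕ → Set
Word n = Fin n → ℕ

Positive : ∀ {n} → Word n → Set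
Positive {n} u = ∀ i → 1 ≤ u i

classes : ∀ {n} → Word n → ℕ
classes {n} u = foldr (λ i acc → u i ⊔ acc) 0 (allFin n)

isIn : ∀ {n} → Subset n → Fin n → Bool
isIn q j = lookup q j

dualQueue : ∀ {n} → Subset n → Subset n
dualQueue q = tabulate (λ i → not (lookup q (opposite i)))

dualWord : ∀ {n} → ℕ → Word n → Word n
dualWord L w i = L + 1 ∸ w (opposite i)

-- σ is a sorting permutation for u: (i_1,...,i_n) = (σ 0, ..., σ (n-1))
-- with u_{i_1} ≤ ... ≤ u_{i_n}.
IsSorting : ∀ {n} → Word n → Permutation′ n → Set
IsSorting {n} u σ = ∀ (a b : Fin n) → a F.≤ b → u (σ ⟨$⟩ʳ a) ≤ u (σ ⟨$⟩ʳ b)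

Partial : ℕ → Set
Partial n = Fin n → Maybe ℕ

isUnset : Maybe ℕ → Bool
isUnset nothing  = true
isUnset (just _) = false

setAt : ∀ {n} → Partial n → Fin n → ℕ → Partial n
setAt v j x k = if-eq (does (j F.≟ k))
  where
  if-eq : Bool → Maybe ℕ
  if-eq true  = just x
  if-eq false = v k

firstSuch : ∀ {n} → (Fin n → Bool) → List (Fin n) → Maybe (Fin n)
firstSuch p []       = nothing
firstSuch p (j ∷ js) with p j
... | true  = just j
... | false = firstSuch p js

leftFrom : ∀ {n} .{{_ : NonZero n}} → Fin n → List (Fin n)
leftFrom {n} i = map (λ t → fromℕ< (m%n<n (toℕ i + n ∸ t) n)) (upTo n)

rightFrom : ∀ {n} .{{_ : NonZero n}} → Fin n → List (Fin n)
rightFrom {n} i = map (λ t → fromℕ< (m%n<n (toℕ i + t) n)) (upTo n)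

-- Assign value x to the first site in the candidate list satisfying `ok`
-- and still unset (nothing happens if there is none; this never occurs).
place : ∀ {n} → (Fin n → Bool) → List (Fin n) → ℕ → Partial n → Partial n
place ok cands x v with firstSuch (λ j → ok j ∧ isUnset (v j)) cands
... | just j  = setAt v j x
... | nothing = v

phaseIStep : ∀ {n} .{{_ : NonZero n}} → Subset n → Word n → Partial n → Fin n → Partial n
phaseIStep q u v i = place (λ j → not (isIn q j)) (leftFrom i) (u i + 1) v

phaseIIStep : ∀ {n} .{{_ : NonZero n}} → Subset n → Word n → Partial n → Fin n → Partial n
phaseIIStep q u v i = place (isIn q) (rightFrom i) (u i) v

-- v = q(u), computed with the sorting permutation σ.
-- Phase I processes i_n, ..., i_{|q|+1}; Phase II processes i_1, ..., i_{|q|}.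
queueOp : ∀ {n} .{{_ : NonZero n}} → Subset n → Word n → Permutation′ n → Word n
queueOp {n} q u σ k = fromMaybe 0 (afterII k)
  where
  order : List (Fin n)
  order = map (σ ⟨$⟩ʳ_) (allFin n)
  afterI : Partial n
  afterI = foldl (phaseIStep q u) (λ _ → nothing) (reverse (drop ∣ q ∣ order))
  afterII : Partial n
  afterII = foldl (phaseIIStep q u) afterI (take ∣ q ∣ order)

-- q(u) is produced by two greedy passes: Phase I places the values u_i + 1 of the n − ∣q∣ largest letters
-- on the sites outside q, each searching leftwards from its own site, and Phase II places the ∣q∣ smallest
-- letters on q, each searching rightwards.  Reflecting the ring (i ↦ n + 1 − i) turns leftward searches into
-- rightward ones, the complement of q into q*, and a value x into ℓ + 2 − x; since u* sorted increasingly is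
-- u sorted decreasingly and reflected, Phase II of q*(u*) is the mirror image of Phase I of q(u) and vice
-- versa.  This needs the output not to depend on the sorting permutation: two placements of equal value
-- commute, because the site taken by the first is the nearest free site of both searches, and beyond a common
-- nearest site the two searches meet the remaining sites in the same order.

module Submission where

open import Defs
open import Data.Nat
open import Data.Nat.Properties
open import Data.Nat.DivMod using (_%_; m%n<n; m%n%n≡m%n; %-distribˡ-+; [m+n]%n≡m%n; m<n⇒m%n≡m; m≤n⇒[n∸m]%m≡n%m)
open import Data.Nat.Tactic.RingSolver using (solve-∀)
open import Data.Bool using (Bool; true; false; not; _∧_; if_then_else_)
open import Data.Bool.Properties using (∧-zeroʳ; ∧-identityʳ; not-involutive)
open import Data.Empty using (⊥-elim)
open import Data.Fin as F using (Fin; toℕ; fromℕ; fromℕ<; inject₁; opposite)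
open import Data.Fin.Properties using (toℕ-fromℕ<; toℕ-injective; toℕ<n; opposite-prop; opposite-involutive)
import Data.Fin.Properties as FinP
open import Data.Fin.Permutation using (Permutation′; _⟨$⟩ʳ_; _⟨$⟩ˡ_; inverseˡ; inverseʳ)
open import Data.Fin.Subset using (Subset; ∣_∣; ∁)
open import Data.Fin.Subset.Properties using (∣p∣≤n; ∣∁p∣≡n∸∣p∣)
open import Data.Vec as V using (lookup)
open import Data.Vec.Properties using (lookup-map; lookup∘tabulate)
open import Data.List using (List; []; _∷_; _++_; map; foldl; foldr; length; reverse; take; drop; filter; upTo; applyUpTo; allFin)
open import Data.List.Properties
  using ( map-upTo; unfold-reverse; filter-accept; filter-++; filter-none; ++-identityʳ; ∷-injectiveʳ; length-map
        ; length-take; length-drop; length-reverse; length-tabulate; take++drop≡id; take-map; drop-map; reverse-map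
        ; map-∘; reverse-++; map-++; reverse-involutive; map-tabulate)
open import Data.List.Extrema.Nat using (max; xs≤max; max≤v⁺)
open import Data.List.Membership.Propositional using (_∈_)
open import Data.List.Membership.Propositional.Properties using (∈-∃++; ∈-filter⁻; ∈-map⁺; ∈-allFin)
open import Data.List.Membership.Propositional.Properties.WithK using (unique∧set⇒bag)
open import Data.List.Relation.Binary.BagAndSetEquality using (∼bag⇒↭)
open import Data.List.Relation.Binary.Permutation.Propositional
  using (_↭_; ↭-refl; ↭-sym; ↭-trans; ↭⇒↭ₛ; module PermutationReasoning)
import Data.List.Relation.Binary.Permutation.Propositional.Properties as ↭
open import Data.List.Relation.Binary.Pointwise using (Pointwise-≡⇒≡)
open import Data.List.Relation.Unary.All as All using (All; []; _∷_)
import Data.List.Relation.Unary.All.Properties as All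
open import Data.List.Relation.Unary.AllPairs as AllPairs using (AllPairs; []; _∷_)
import Data.List.Relation.Unary.AllPairs.Properties as AllPairs
open import Data.List.Relation.Unary.Any using (here; there)
import Data.List.Relation.Unary.Any.Properties as Any
open import Data.List.Relation.Unary.Sorted.TotalOrder.Properties using (↗↭↗⇒≋; AllPairs⇒Sorted)
open import Data.List.Relation.Unary.Unique.Propositional using (Unique)
import Data.List.Relation.Unary.Unique.Propositional.Properties as Unique
open import Data.Maybe as Maybe using (Maybe; just; nothing; fromMaybe)
open import Data.Maybe.Properties using (just-injective)
open import Data.Product using (∃; Σ-syntax; _×_; _,_; proj₁)
open import Function using (_∘_; id; flip)
open import Function.Bundles using (mk⇔)
open import Relation.Binary.Bundles using (Setoid)
import Relation.Binary.Reasoning.Setoid as ≈-Reasoning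
open import Relation.Binary.PropositionalEquality
open import Relation.Nullary using (Dec; yes; no)

indicator : Bool → ℕ
indicator true  = 1
indicator false = 0

count : ∀ {m} → (Fin m → Bool) → ℕ
count {zero}  f = 0
count {suc m} f = indicator (f F.zero) + count (f ∘ F.suc)

count-cong : ∀ {m} {f g : Fin m → Bool} → (∀ j → f j ≡ g j) → count f ≡ count g
count-cong {zero}  f≗g = refl
count-cong {suc m} f≗g = cong₂ _+_ (cong indicator (f≗g F.zero)) (count-cong (f≗g ∘ F.suc))

all-false⇒count≡0 : ∀ {m} {f : Fin m → Bool} → (∀ j → f j ≡ false) → count f ≡ 0
all-false⇒count≡0 {zero}      _   = refl
all-false⇒count≡0 {suc m} {f} f≗0 rewrite f≗0 F.zero = all-false⇒count≡0 (f≗0 ∘ F.suc)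

count≡0⇒all-false : ∀ {m} {f : Fin m → Bool} → count f ≡ 0 → ∀ j → f j ≡ false
count≡0⇒all-false {suc m} {f} c≡0 j with f F.zero in f0
count≡0⇒all-false {suc m} {f} c≡0 F.zero    | false = f0
count≡0⇒all-false {suc m} {f} c≡0 (F.suc j) | false = count≡0⇒all-false c≡0 j

count-switchOff : ∀ {m} {f g : Fin m → Bool} d → f d ≡ true → g d ≡ false →
                  (∀ j → d ≢ j → g j ≡ f j) → count f ≡ suc (count g)
count-switchOff {suc m} F.zero fd gd f≗g rewrite fd | gd =
  cong suc (count-cong (λ j → sym (f≗g (F.suc j) λ ())))
count-switchOff {suc m} {f} (F.suc d) fd gd f≗g rewrite f≗g F.zero (λ ()) =
  trans (cong (indicator (f F.zero) +_)
              (count-switchOff d fd gd (λ j d≢j → f≗g (F.suc j) (d≢j ∘ FinP.suc-injective))))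
        (+-suc _ _)

count-lookup : ∀ {m} (p : Subset m) → count (lookup p) ≡ ∣ p ∣
count-lookup V.[]          = refl
count-lookup (true  V.∷ p) = cong suc (count-lookup p)
count-lookup (false V.∷ p) = count-lookup p

count-not-lookup : ∀ {m} (p : Subset m) → count (not ∘ lookup p) ≡ m ∸ ∣ p ∣
count-not-lookup p = trans (count-cong (λ j → sym (lookup-map j not p))) (trans (count-lookup (∁ p)) (∣∁p∣≡n∸∣p∣ p))

count-last : ∀ {m} (f : Fin (suc m) → Bool) →
             count f ≡ count (f ∘ inject₁) + indicator (f (fromℕ m))
count-last {zero}  f = +-comm (indicator (f F.zero)) 0
count-last {suc m} f = trans (cong (indicator (f F.zero) +_) (count-last (f ∘ F.suc)))
                             (sym (+-assoc (indicator (f F.zero)) _ _))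

count-opposite : ∀ {m} (f : Fin m → Bool) → count (f ∘ opposite) ≡ count f
count-opposite {zero}  f = refl
count-opposite {suc m} f = begin
  indicator (f (fromℕ m)) + count (f ∘ opposite ∘ F.suc) ≡⟨ cong (indicator (f (fromℕ m)) +_) (count-opposite (f ∘ inject₁)) ⟩
  indicator (f (fromℕ m)) + count (f ∘ inject₁)          ≡⟨ +-comm (indicator (f (fromℕ m))) _ ⟩
  count (f ∘ inject₁) + indicator (f (fromℕ m))          ≡⟨ count-last f ⟨
  count f                                                      ∎
  where open ≡-Reasoning

module _ {m : ℕ} where

  firstSuch-none : ∀ {p : Fin m → Bool} → (∀ j → p j ≡ false) → ∀ xs → firstSuch p xs ≡ nothing
  firstSuch-none p≗false [] = refl
  firstSuch-none {p} p≗false (x ∷ xs) with p x | p≗false x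
  ... | false | _ = firstSuch-none p≗false xs

  firstSuch-applyUpTo-just : ∀ (h : ℕ → Fin m) k p {d} → firstSuch p (applyUpTo h k) ≡ just d →
    Σ[ t ∈ ℕ ] t < k × h t ≡ d × p d ≡ true × (∀ t′ → t′ < t → p (h t′) ≡ false)
  firstSuch-applyUpTo-just h (suc k) p eq with p (h 0) in p0
  firstSuch-applyUpTo-just h (suc k) p refl | true = 0 , z<s , refl , p0 , λ _ ()
  ... | false with firstSuch-applyUpTo-just (h ∘ suc) k p eq
  ... | t , t<k , ht≡d , pd , before =
    suc t , s<s t<k , ht≡d , pd , λ { zero _ → p0 ; (suc t′) t′<t → before t′ (s<s⁻¹ t′<t) }

  firstSuch-applyUpTo-nothing : ∀ (h : ℕ → Fin m) k p → firstSuch p (applyUpTo h k) ≡ nothing →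
    ∀ t → t < k → p (h t) ≡ false
  firstSuch-applyUpTo-nothing h (suc k) p eq t t<k with p (h 0) in p0
  firstSuch-applyUpTo-nothing h (suc k) p eq zero    t<k       | false = p0
  firstSuch-applyUpTo-nothing h (suc k) p eq (suc t) (s<s t<k) | false =
    firstSuch-applyUpTo-nothing (h ∘ suc) k p eq t t<k

module _ {A : Set} where

  take-length-++ : ∀ (xs ys : List A) → take (length xs) (xs ++ ys) ≡ xs
  take-length-++ []       ys = refl
  take-length-++ (x ∷ xs) ys = cong (x ∷_) (take-length-++ xs ys)

  drop-length-++ : ∀ (xs ys : List A) → drop (length xs) (xs ++ ys) ≡ ys
  drop-length-++ []       ys = refl
  drop-length-++ (x ∷ xs) ys = drop-length-++ xs ys

  All-reverse : ∀ {P : A → Set} {xs} → All P xs → All P (reverse xs)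
  All-reverse {xs = []}         []         = []
  All-reverse {P} {xs = x ∷ xs} (px ∷ pxs) =
    subst (All P) (sym (unfold-reverse x xs)) (All.++⁺ (All-reverse pxs) (px ∷ []))

  AllPairs-reverse : ∀ {R : A → A → Set} {xs} → AllPairs R xs → AllPairs (flip R) (reverse xs)
  AllPairs-reverse {xs = []}         []         = []
  AllPairs-reverse {R} {xs = x ∷ xs} (rx ∷ rxs) = subst (AllPairs (flip R)) (sym (unfold-reverse x xs))
    (AllPairs.++⁺ (AllPairs-reverse rxs) ([] ∷ []) (All-reverse (All.map (_∷ []) rx)))

  AllPairs-++⇒All-All : ∀ {R : A → A → Set} xs {ys} → AllPairs R (xs ++ ys) → All (λ x → All (R x) ys) xs
  AllPairs-++⇒All-All []       _          = []
  AllPairs-++⇒All-All (x ∷ xs) (rx ∷ rxs) = All.++⁻ʳ xs rx ∷ AllPairs-++⇒All-All xs rxs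

  All-dropMiddle : ∀ {P : A → Set} xs {x ys} → All P (xs ++ x ∷ ys) → All P (xs ++ ys)
  All-dropMiddle xs pxs = All.++⁺ (All.++⁻ˡ xs pxs) (All.tail (All.++⁻ʳ xs pxs))

  AllPairs-dropMiddle : ∀ {R : A → A → Set} xs {x ys} → AllPairs R (xs ++ x ∷ ys) → AllPairs R (xs ++ ys)
  AllPairs-dropMiddle []       (_ ∷ rys)  = rys
  AllPairs-dropMiddle (x ∷ xs) (rx ∷ rxs) = All-dropMiddle xs rx ∷ AllPairs-dropMiddle xs rxs

sorted-↭⇒≡ : ∀ {xs ys : List ℕ} → AllPairs _≤_ xs → AllPairs _≤_ ys → xs ↭ ys → xs ≡ ys
sorted-↭⇒≡ sxs sys xs↭ys = Pointwise-≡⇒≡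
  (↗↭↗⇒≋ ≤-totalOrder (AllPairs⇒Sorted ≤-totalOrder sxs) (AllPairs⇒Sorted ≤-totalOrder sys) (↭⇒↭ₛ xs↭ys))

module CyclicDifference (n : ℕ) .{{_ : NonZero n}} where
  open ≡-Reasoning

  infixl 7 _⊖_
  _⊖_ : ℕ → ℕ → ℕ
  a ⊖ b = (a + n ∸ b) % n

  ⊖<n : ∀ a b → a ⊖ b < n
  ⊖<n a b = m%n<n (a + n ∸ b) n

  [m%n+k]%n≡[m+k]%n : ∀ m k → (m % n + k) % n ≡ (m + k) % n
  [m%n+k]%n≡[m+k]%n m k = begin
    (m % n + k) % n         ≡⟨ %-distribˡ-+ (m % n) k n ⟩
    (m % n % n + k % n) % n ≡⟨ cong (λ z → (z + k % n) % n) (m%n%n≡m%n m n) ⟩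
    (m % n + k % n) % n     ≡⟨ %-distribˡ-+ m k n ⟨
    (m + k) % n             ∎

  a⊖b≡[a+[n∸b]]%n : ∀ a {b} → b ≤ n → a ⊖ b ≡ (a + (n ∸ b)) % n
  a⊖b≡[a+[n∸b]]%n a b≤n = cong (_% n) (+-∸-assoc a b≤n)

  [a⊖b+b]%n≡a : ∀ {a b} → a < n → b < n → (a ⊖ b + b) % n ≡ a
  [a⊖b+b]%n≡a {a} {b} a<n b<n = begin
    (a ⊖ b + b) % n             ≡⟨ [m%n+k]%n≡[m+k]%n (a + n ∸ b) b ⟩
    (a + n ∸ b + b) % n         ≡⟨ cong (_% n) (m∸n+n≡m (≤-trans (<⇒≤ b<n) (m≤n+m n a))) ⟩
    (a + n) % n                 ≡⟨ [m+n]%n≡m%n a n ⟩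
    a % n                       ≡⟨ m<n⇒m%n≡m a<n ⟩
    a                           ∎

  [x+b]%n≡a⇒a⊖b≡x : ∀ {x b a} → x < n → b < n → (x + b) % n ≡ a → a ⊖ b ≡ x
  [x+b]%n≡a⇒a⊖b≡x {x} {b} {a} x<n b<n refl = begin
    (x + b) % n ⊖ b               ≡⟨ a⊖b≡[a+[n∸b]]%n ((x + b) % n) (<⇒≤ b<n) ⟩
    ((x + b) % n + (n ∸ b)) % n   ≡⟨ [m%n+k]%n≡[m+k]%n (x + b) (n ∸ b) ⟩
    (x + b + (n ∸ b)) % n         ≡⟨ cong (_% n) (+-assoc x b (n ∸ b)) ⟩
    (x + (b + (n ∸ b))) % n       ≡⟨ cong (λ m → (x + m) % n) (m+[n∸m]≡n (<⇒≤ b<n)) ⟩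
    (x + n) % n                   ≡⟨ [m+n]%n≡m%n x n ⟩
    x % n                         ≡⟨ m<n⇒m%n≡m x<n ⟩
    x                             ∎

  a⊖[a⊖b]≡b : ∀ {a b} → a < n → b < n → a ⊖ (a ⊖ b) ≡ b
  a⊖[a⊖b]≡b {a} {b} a<n b<n = [x+b]%n≡a⇒a⊖b≡x b<n (⊖<n a b)
    (trans (cong (_% n) (+-comm b (a ⊖ b))) ([a⊖b+b]%n≡a a<n b<n))

  [a+t]%n⊖a≡t : ∀ {a t} → a < n → t < n → (a + t) % n ⊖ a ≡ t
  [a+t]%n⊖a≡t {a} {t} a<n t<n = [x+b]%n≡a⇒a⊖b≡x t<n a<n (cong (_% n) (+-comm t a))

  [a+[b⊖a]]%n≡b : ∀ {a b} → a < n → b < n → (a + (b ⊖ a)) % n ≡ b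
  [a+[b⊖a]]%n≡b {a} {b} a<n b<n = trans (cong (_% n) (+-comm a (b ⊖ a))) ([a⊖b+b]%n≡a b<n a<n)

  -- If x + y wrapped around, a ⊖ b would be x + y ∸ n < x.
  ⊖-split : ∀ {x y b a} → x < n → y < n → b < n → (x + y + b) % n ≡ a → x ≤ a ⊖ b → a ⊖ b ≡ x + y
  ⊖-split {x} {y} {b} {a} x<n y<n b<n eq x≤a⊖b with x + y <? n
  ... | yes x+y<n = [x+b]%n≡a⇒a⊖b≡x x+y<n b<n eq
  ... | no x+y≮n = ⊥-elim (<⇒≱ a⊖b<x x≤a⊖b)
    where
    n≤x+y : n ≤ x + y
    n≤x+y = ≮⇒≥ x+y≮n
    wrapped : x + y ∸ n + n ≡ x + y
    wrapped = m∸n+n≡m n≤x+y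
    a⊖b≡x+y∸n : a ⊖ b ≡ x + y ∸ n
    a⊖b≡x+y∸n = [x+b]%n≡a⇒a⊖b≡x
      (+-cancelʳ-< n (x + y ∸ n) n (subst (_< n + n) (sym wrapped) (+-mono-< x<n y<n)))
      b<n
      (begin
        (x + y ∸ n + b) % n ≡⟨ cong (_% n) (+-∸-comm b n≤x+y) ⟨
        (x + y + b ∸ n) % n ≡⟨ m≤n⇒[n∸m]%m≡n%m (≤-trans n≤x+y (m≤m+n (x + y) b)) ⟩
        (x + y + b) % n     ≡⟨ eq ⟩
        a                   ∎)
    a⊖b<x : a ⊖ b < x
    a⊖b<x = subst (_< x) (sym a⊖b≡x+y∸n)
      (+-cancelʳ-< n (x + y ∸ n) x (subst (_< x + n) (sym wrapped) (+-monoʳ-< x y<n)))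

  [x+[y+b]%n]%n≡[x+y+b]%n : ∀ x y b → (x + ((y + b) % n)) % n ≡ (x + y + b) % n
  [x+[y+b]%n]%n≡[x+y+b]%n x y b = begin
    (x + (y + b) % n) % n ≡⟨ cong (_% n) (+-comm x ((y + b) % n)) ⟩
    ((y + b) % n + x) % n ≡⟨ [m%n+k]%n≡[m+k]%n (y + b) x ⟩
    (y + b + x) % n       ≡⟨ cong (_% n) (trans (+-comm (y + b) x) (sym (+-assoc x y b))) ⟩
    (x + y + b) % n       ∎

  ⊖-triangleˡ : ∀ {a c j} → a < n → c < n → j < n → a ⊖ c ≤ a ⊖ j → a ⊖ j ≡ a ⊖ c + c ⊖ j
  ⊖-triangleˡ {a} {c} {j} a<n c<n j<n = ⊖-split (⊖<n a c) (⊖<n c j) j<n (begin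
    (a ⊖ c + c ⊖ j + j) % n       ≡⟨ [x+[y+b]%n]%n≡[x+y+b]%n (a ⊖ c) (c ⊖ j) j ⟨
    (a ⊖ c + (c ⊖ j + j) % n) % n ≡⟨ cong (λ m → (a ⊖ c + m) % n) ([a⊖b+b]%n≡a c<n j<n) ⟩
    (a ⊖ c + c) % n               ≡⟨ [a⊖b+b]%n≡a a<n c<n ⟩
    a                             ∎)

  ⊖-triangleʳ : ∀ {a c j} → a < n → c < n → j < n → c ⊖ a ≤ j ⊖ a → j ⊖ a ≡ c ⊖ a + j ⊖ c
  ⊖-triangleʳ {a} {c} {j} a<n c<n j<n = ⊖-split (⊖<n c a) (⊖<n j c) a<n (begin
    (c ⊖ a + j ⊖ c + a) % n       ≡⟨ cong (λ m → (m + a) % n) (+-comm (c ⊖ a) (j ⊖ c)) ⟩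
    (j ⊖ c + c ⊖ a + a) % n       ≡⟨ [x+[y+b]%n]%n≡[x+y+b]%n (j ⊖ c) (c ⊖ a) a ⟨
    (j ⊖ c + (c ⊖ a + a) % n) % n ≡⟨ cong (λ m → (j ⊖ c + m) % n) ([a⊖b+b]%n≡a c<n a<n) ⟩
    (j ⊖ c + c) % n               ≡⟨ [a⊖b+b]%n≡a j<n c<n ⟩
    j                             ∎)

  [n∸1+a]⊖[n∸1+j]≡j⊖a : ∀ {a j} → a < n → j < n → (n ∸ suc a) ⊖ (n ∸ suc j) ≡ j ⊖ a
  [n∸1+a]⊖[n∸1+j]≡j⊖a {a} {j} a<n j<n = cong (_% n) (begin
    a′ + n ∸ j′              ≡⟨ cong (λ m → a′ + m ∸ j′) (sym (m∸n+n≡m j<n)) ⟩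
    a′ + (j′ + suc j) ∸ j′   ≡⟨ cong (_∸ j′) (x+[y+z]≡y+[x+z] a′ j′ (suc j)) ⟩
    j′ + (a′ + suc j) ∸ j′   ≡⟨ m+n∸m≡n j′ (a′ + suc j) ⟩
    a′ + suc j               ≡⟨ m+n∸n≡m (a′ + suc j) a ⟨
    a′ + suc j + a ∸ a       ≡⟨ cong (_∸ a) (x+[1+y]+z≡y+[x+[1+z]] a′ j a) ⟩
    j + (a′ + suc a) ∸ a     ≡⟨ cong (λ m → j + m ∸ a) (m∸n+n≡m a<n) ⟩
    j + n ∸ a                ∎)
    where
    a′ = n ∸ suc a
    j′ = n ∸ suc j
    x+[y+z]≡y+[x+z] : ∀ x y z → x + (y + z) ≡ y + (x + z)
    x+[y+z]≡y+[x+z] = solve-∀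
    x+[1+y]+z≡y+[x+[1+z]] : ∀ x y z → x + suc y + z ≡ y + (x + suc z)
    x+[1+y]+z≡y+[x+[1+z]] = solve-∀

module Searching (n : ℕ) .{{_ : NonZero n}} where

  record SearchOrder : Set where
    field
      nth               : Fin n → ℕ → Fin n
      distance          : Fin n → Fin n → ℕ
      distance-nth      : ∀ a {t} → t < n → distance a (nth a t) ≡ t
      nth-distance      : ∀ a j → nth a (distance a j) ≡ j
      distance<n        : ∀ a j → distance a j < n
      distance-triangle : ∀ a c j → distance a c ≤ distance a j → distance a j ≡ distance a c + distance c j

    candidates : Fin n → List (Fin n)
    candidates a = map (nth a) (upTo n)

    Nearest : (Fin n → Bool) → Fin n → Fin n → Set
    Nearest p a d = p d ≡ true × (∀ j → p j ≡ true → distance a d ≤ distance a j)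

    distance-injective : ∀ a {d d′} → distance a d ≡ distance a d′ → d ≡ d′
    distance-injective a {d} {d′} eq = trans (sym (nth-distance a d)) (trans (cong (nth a) eq) (nth-distance a d′))

    Nearest-unique : ∀ {p a d d′} → Nearest p a d → Nearest p a d′ → d ≡ d′
    Nearest-unique (pd , d≤) (pd′ , d′≤) = distance-injective _ (≤-antisym (d≤ _ pd′) (d′≤ _ pd))

    Nearest-cong : ∀ {p p′ a d} → p ≗ p′ → Nearest p a d → Nearest p′ a d
    Nearest-cong p≗p′ (pd , d≤) = trans (sym (p≗p′ _)) pd , λ j p′j → d≤ j (trans (p≗p′ j) p′j)

    Nearest-⊆ : ∀ {p p′ a d} → (∀ j → p′ j ≡ true → p j ≡ true) → p′ d ≡ true → Nearest p a d → Nearest p′ a d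
    Nearest-⊆ p′⊆p p′d (_ , d≤) = p′d , λ j p′j → d≤ j (p′⊆p j p′j)

    Nearest-beyond : ∀ {p p′ a b c e} → (∀ j → p′ j ≡ true → p j ≡ true) →
                     Nearest p a c → Nearest p b c → Nearest p′ a e → Nearest p′ b e
    Nearest-beyond {p} {p′} {a} {b} {c} {e} p′⊆p (_ , c≤ᵃ) (_ , c≤ᵇ) (p′e , e≤) = p′e , e≤ᵇ
      where
      e≤ᵇ : ∀ j → p′ j ≡ true → distance b e ≤ distance b j
      e≤ᵇ j p′j = subst₂ _≤_ (sym (split b c≤ᵇ e p′e)) (sym (split b c≤ᵇ j p′j)) (+-monoʳ-≤ (distance b c) e≤ʲ)
        where
        split : ∀ x → (∀ i → p i ≡ true → distance x c ≤ distance x i) →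
                ∀ i → p′ i ≡ true → distance x i ≡ distance x c + distance c i
        split x c≤ i p′i = distance-triangle x c i (c≤ i (p′⊆p i p′i))
        e≤ʲ : distance c e ≤ distance c j
        e≤ʲ = +-cancelˡ-≤ (distance a c) _ _ (subst₂ _≤_ (split a c≤ᵃ e p′e) (split a c≤ᵃ j p′j) (e≤ j p′j))

    firstSuch-just⇒Nearest : ∀ a p {d} → firstSuch p (candidates a) ≡ just d → Nearest p a d
    firstSuch-just⇒Nearest a p {d} eq
      with t , t<n , nth≡d , pd , before ← firstSuch-applyUpTo-just (nth a) n p (trans (cong (firstSuch p) (sym (map-upTo (nth a) n))) eq)
      = pd , λ j pj → subst (_≤ distance a j) (trans (sym (distance-nth a t<n)) (cong (distance a) nth≡d)) (t≤ j pj)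
      where
      t≤ : ∀ j → p j ≡ true → t ≤ distance a j
      t≤ j pj with t ≤? distance a j
      ... | yes t≤j = t≤j
      ... | no t≰j with () ← trans (sym pj) (trans (cong p (sym (nth-distance a j))) (before (distance a j) (≰⇒> t≰j)))

    firstSuch-nothing⇒false : ∀ a p → firstSuch p (candidates a) ≡ nothing → ∀ j → p j ≡ false
    firstSuch-nothing⇒false a p eq j = trans (cong p (sym (nth-distance a j)))
      (firstSuch-applyUpTo-nothing (nth a) n p (trans (cong (firstSuch p) (sym (map-upTo (nth a) n))) eq) (distance a j) (distance<n a j))

  open SearchOrder

  open CyclicDifference n

  leftSearch : SearchOrder
  leftSearch = record
    { nth               = λ a t → fromℕ< (m%n<n (toℕ a + n ∸ t) n)
    ; distance          = λ a j → toℕ a ⊖ toℕ j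
    ; distance-nth      = λ a {t} t<n →
        trans (cong (toℕ a ⊖_) (toℕ-fromℕ< (m%n<n (toℕ a + n ∸ t) n))) (a⊖[a⊖b]≡b (toℕ<n a) t<n)
    ; nth-distance      = λ a j → toℕ-injective (trans (toℕ-fromℕ< _) (a⊖[a⊖b]≡b (toℕ<n a) (toℕ<n j)))
    ; distance<n        = λ a j → ⊖<n (toℕ a) (toℕ j)
    ; distance-triangle = λ a c j → ⊖-triangleˡ (toℕ<n a) (toℕ<n c) (toℕ<n j)
    }

  rightSearch : SearchOrder
  rightSearch = record
    { nth               = λ a t → fromℕ< (m%n<n (toℕ a + t) n)
    ; distance          = λ a j → toℕ j ⊖ toℕ a
    ; distance-nth      = λ a {t} t<n →
        trans (cong (_⊖ toℕ a) (toℕ-fromℕ< (m%n<n (toℕ a + t) n))) ([a+t]%n⊖a≡t (toℕ<n a) t<n)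
    ; nth-distance      = λ a j → toℕ-injective (trans (toℕ-fromℕ< _) ([a+[b⊖a]]%n≡b (toℕ<n a) (toℕ<n j)))
    ; distance<n        = λ a j → ⊖<n (toℕ j) (toℕ a)
    ; distance-triangle = λ a c j → ⊖-triangleʳ (toℕ<n a) (toℕ<n c) (toℕ<n j)
    }

  left-distance-opposite : ∀ a j → distance leftSearch (opposite a) (opposite j) ≡ distance rightSearch a j
  left-distance-opposite a j rewrite opposite-prop a | opposite-prop j = [n∸1+a]⊖[n∸1+j]≡j⊖a (toℕ<n a) (toℕ<n j)

  right-distance-opposite : ∀ a j → distance rightSearch (opposite a) (opposite j) ≡ distance leftSearch a j
  right-distance-opposite a j rewrite opposite-prop a | opposite-prop j = [n∸1+a]⊖[n∸1+j]≡j⊖a (toℕ<n j) (toℕ<n a)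

module Placing (n : ℕ) .{{_ : NonZero n}} where
  open Searching n
  open SearchOrder

  State : Set
  State = Partial n

  module ≗ = Setoid (Fin n →-setoid Maybe ℕ)

  empty : State
  empty _ = nothing

  setAt-≡ : ∀ (s : State) j x → setAt s j x j ≡ just x
  setAt-≡ s j x with j F.≟ j
  ... | yes _   = refl
  ... | no j≢j = ⊥-elim (j≢j refl)

  setAt-≢ : ∀ (s : State) j x {k} → j ≢ k → setAt s j x k ≡ s k
  setAt-≢ s j x {k} j≢k with j F.≟ k
  ... | yes j≡k = ⊥-elim (j≢k j≡k)
  ... | no _    = refl

  setAt-cong : ∀ {s t : State} → s ≗ t → ∀ j x → setAt s j x ≗ setAt t j x
  setAt-cong s≗t j x k with j F.≟ k
  ... | yes _ = refl
  ... | no _  = s≗t k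

  setAt-comm : ∀ (s : State) c d x → setAt (setAt s c x) d x ≗ setAt (setAt s d x) c x
  setAt-comm s c d x k with d F.≟ k | c F.≟ k
  ... | yes refl | yes refl = refl
  ... | yes refl | no c≢k   = sym (setAt-≡ s d x)
  ... | no d≢k   | yes refl = setAt-≡ s c x
  ... | no d≢k   | no c≢k   = trans (setAt-≢ s c x c≢k) (sym (setAt-≢ s d x d≢k))

  setAt-val : ∀ (s : State) j {x y} → x ≡ y → setAt s j x ≗ setAt s j y
  setAt-val s j refl k = refl

  free : (Fin n → Bool) → State → Fin n → Bool
  free ok s j = ok j ∧ isUnset (s j)

  free-cong : ∀ ok {s t : State} → s ≗ t → free ok s ≗ free ok t
  free-cong ok s≗t j = cong (λ m → ok j ∧ isUnset m) (s≗t j)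

  free-setAt-≡ : ∀ ok (s : State) c x → free ok (setAt s c x) c ≡ false
  free-setAt-≡ ok s c x = trans (cong (λ m → ok c ∧ isUnset m) (setAt-≡ s c x)) (∧-zeroʳ (ok c))

  free-setAt-≢ : ∀ ok (s : State) c x {j} → c ≢ j → free ok (setAt s c x) j ≡ free ok s j
  free-setAt-≢ ok s c x {j} c≢j = cong (λ m → ok j ∧ isUnset m) (setAt-≢ s c x c≢j)

  free-setAt⇒≢ : ∀ ok (s : State) c x {j} → free ok (setAt s c x) j ≡ true → c ≢ j
  free-setAt⇒≢ ok s c x fj refl with () ← trans (sym fj) (free-setAt-≡ ok s c x)

  free-setAt⇒free : ∀ ok (s : State) c x j → free ok (setAt s c x) j ≡ true → free ok s j ≡ true
  free-setAt⇒free ok s c x j fj = trans (sym (free-setAt-≢ ok s c x (free-setAt⇒≢ ok s c x fj))) fj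

  occupied : ∀ ok (s : State) {j} → ok j ≡ true → free ok s j ≡ false → ∃ λ x → s j ≡ just x
  occupied ok s {j} okj fj with s j
  ... | just x  = x , refl
  ... | nothing with () ← trans (sym okj) (trans (sym (∧-identityʳ (ok j))) fj)

  place-just : ∀ ok cs x (s : State) {d} → firstSuch (free ok s) cs ≡ just d → place ok cs x s ≗ setAt s d x
  place-just ok cs x s eq k rewrite eq = refl

  place-nothing : ∀ ok cs x (s : State) → firstSuch (free ok s) cs ≡ nothing → place ok cs x s ≗ s
  place-nothing ok cs x s eq k rewrite eq = refl

  module Steps (S : SearchOrder) (ok : Fin n → Bool) (val : Fin n → ℕ) where

    step : State → Fin n → State
    step s a = place ok (candidates S a) (val a) s

    data StepView (s : State) (a : Fin n) : Set where
      blocked : (∀ j → free ok s j ≡ false) → step s a ≗ s → StepView s a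
      fills   : ∀ d → Nearest S (free ok s) a d → step s a ≗ setAt s d (val a) → StepView s a

    view : ∀ s a → StepView s a
    view s a with firstSuch (free ok s) (candidates S a) in eq
    ... | nothing = blocked (firstSuch-nothing⇒false S a (free ok s) eq) (place-nothing ok (candidates S a) (val a) s eq)
    ... | just d  = fills d (firstSuch-just⇒Nearest S a (free ok s) eq) (place-just ok (candidates S a) (val a) s eq)

    step-nearest : ∀ {s a d} → Nearest S (free ok s) a d → step s a ≗ setAt s d (val a)
    step-nearest {s} {a} nearest with view s a
    ... | blocked none _  with () ← trans (sym (proj₁ nearest)) (none _)
    ... | fills d′ nearest′ s≗ rewrite Nearest-unique S nearest nearest′ = s≗

    step-blocked : ∀ {s a} → (∀ j → free ok s j ≡ false) → step s a ≗ s
    step-blocked {s} {a} none = place-nothing ok (candidates S a) (val a) s (firstSuch-none none (candidates S a))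

    step-cong : ∀ {s t} → s ≗ t → ∀ a → step s a ≗ step t a
    step-cong {s} {t} s≗t a with view s a
    ... | blocked none s≗ = ≗.trans s≗ (≗.trans s≗t (≗.sym (step-blocked {t} {a} λ j → trans (sym (free-cong ok s≗t j)) (none j))))
    ... | fills d nearest s≗ =
      ≗.trans s≗ (≗.trans (setAt-cong s≗t d (val a)) (≗.sym (step-nearest (Nearest-cong S (free-cong ok s≗t) nearest))))

    step-setAt : ∀ {s a d} → Nearest S (free ok s) a d → ∀ {x} → val a ≡ x → step s a ≗ setAt s d x
    step-setAt nearest refl = step-nearest nearest

    Nearest-setAt : ∀ {s b c d} x → c ≢ d → Nearest S (free ok s) b d → Nearest S (free ok (setAt s c x)) b d
    Nearest-setAt {s} {c = c} x c≢d nearest =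
      Nearest-⊆ S (free-setAt⇒free ok s c x) (trans (free-setAt-≢ ok s c x c≢d) (proj₁ nearest)) nearest

    step-comm : ∀ s a b → val a ≡ val b → step (step s a) b ≗ step (step s b) a
    step-comm s a b va≡vb with view s a | view s b
    ... | blocked none sa≗ | _ =
      ≗.trans (step-cong sa≗ b) (≗.trans (step-blocked none) (≗.sym (≗.trans (step-cong (step-blocked none) a) sa≗)))
    ... | fills c (fc , _) _ | blocked none _ with () ← trans (sym fc) (none c)
    ... | fills c nearestᵃ sa≗ | fills d nearestᵇ sb≗ = begin
      step (step s a) b             ≈⟨ step-cong sa≗ b ⟩
      step (setAt s c (val a)) b    ≈⟨ second-steps (c F.≟ d) ⟩
      step (setAt s d (val a)) a    ≈⟨ step-cong (≗.trans sb≗ (setAt-val s d (sym va≡vb))) a ⟨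
      step (step s b) a             ∎
      where
      open ≈-Reasoning (Fin n →-setoid Maybe ℕ)
      second-steps : Dec (c ≡ d) → step (setAt s c (val a)) b ≗ step (setAt s d (val a)) a
      second-steps (no c≢d) = begin
        step (setAt s c (val a)) b            ≈⟨ step-setAt (Nearest-setAt (val a) c≢d nearestᵇ) (sym va≡vb) ⟩
        setAt (setAt s c (val a)) d (val a)   ≈⟨ setAt-comm s c d (val a) ⟩
        setAt (setAt s d (val a)) c (val a)   ≈⟨ step-nearest (Nearest-setAt (val a) (c≢d ∘ sym) nearestᵃ) ⟨
        step (setAt s d (val a)) a            ∎
      second-steps (yes refl) with view (setAt s c (val a)) a
      ... | blocked none s₁a≗     = ≗.trans (step-blocked none) (≗.sym s₁a≗)
      ... | fills e nearestᵉ s₁a≗ = ≗.trans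
        (step-setAt (Nearest-beyond S (free-setAt⇒free ok s c (val a)) nearestᵃ nearestᵇ nearestᵉ) (sym va≡vb)) (≗.sym s₁a≗)

    foldl-cong : ∀ {s t} → s ≗ t → ∀ xs → foldl step s xs ≗ foldl step t xs
    foldl-cong s≗t []       = s≗t
    foldl-cong s≗t (a ∷ xs) = foldl-cong (step-cong s≗t a) xs

    freeCount : State → ℕ
    freeCount s = count (free ok s)

    freeCount-cong : ∀ {s t} → s ≗ t → freeCount s ≡ freeCount t
    freeCount-cong s≗t = count-cong (free-cong ok s≗t)

    freeCount-setAt : ∀ s d x → free ok s d ≡ true → freeCount s ≡ suc (freeCount (setAt s d x))
    freeCount-setAt s d x fd = count-switchOff d fd (free-setAt-≡ ok s d x) (λ j → free-setAt-≢ ok s d x)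

    step-freeCount : ∀ s a {c} → freeCount s ≡ suc c → freeCount (step s a) ≡ c
    step-freeCount s a fc≡ with view s a
    ... | blocked none _ with () ← trans (sym (all-false⇒count≡0 none)) fc≡
    ... | fills d (fd , _) sa≗ =
      suc-injective (trans (cong suc (freeCount-cong sa≗)) (trans (sym (freeCount-setAt s d (val a) fd)) fc≡))

    foldl-exhausts : ∀ s xs → freeCount s ≡ length xs → ∀ j → free ok (foldl step s xs) j ≡ false
    foldl-exhausts s []       fc≡ = count≡0⇒all-false fc≡
    foldl-exhausts s (a ∷ xs) fc≡ = foldl-exhausts (step s a) xs (step-freeCount s a fc≡)

    fill : State → ℕ → State
    fill s x j = if free ok s j then just x else s j

    fill-blocked : ∀ s x → (∀ j → free ok s j ≡ false) → fill s x ≗ s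
    fill-blocked s x none j rewrite none j = refl

    fill-setAt : ∀ s d x → free ok s d ≡ true → fill (setAt s d x) x ≗ fill s x
    fill-setAt s d x fd k = case-≟ (d F.≟ k)
      where
      case-≟ : Dec (d ≡ k) → fill (setAt s d x) x k ≡ fill s x k
      case-≟ (yes refl) rewrite free-setAt-≡ ok s d x | fd = setAt-≡ s d x
      case-≟ (no d≢k)   rewrite free-setAt-≢ ok s d x d≢k | setAt-≢ s d x d≢k = refl

    foldl-fill : ∀ xs s x → freeCount s ≡ length xs → All (λ a → val a ≡ x) xs → foldl step s xs ≗ fill s x
    foldl-fill []       s x fc≡ [] = ≗.sym (fill-blocked s x (count≡0⇒all-false fc≡))
    foldl-fill (a ∷ xs) s x fc≡ (va≡x ∷ vxs) with view s a
    ... | blocked none _ with () ← trans (sym (all-false⇒count≡0 none)) fc≡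
    ... | fills d (fd , _) sa≗ = begin
      foldl step (step s a) xs       ≈⟨ foldl-cong (≗.trans sa≗ (setAt-val s d va≡x)) xs ⟩
      foldl step (setAt s d x) xs    ≈⟨ foldl-fill xs (setAt s d x) x (suc-injective (trans (sym (freeCount-setAt s d x fd)) fc≡)) vxs ⟩
      fill (setAt s d x) x           ≈⟨ fill-setAt s d x fd ⟩
      fill s x                       ∎
      where open ≈-Reasoning (Fin n →-setoid Maybe ℕ)

    module Reordering (key : Fin n → ℕ) (key⇒val : ∀ a b → key a ≡ key b → val a ≡ val b) where

      Sorted : List (Fin n) → Set
      Sorted = AllPairs (λ a b → key a ≤ key b)

      All-keys : ∀ {P : ℕ → Set} {xs ys} → map key xs ≡ map key ys → All (P ∘ key) xs → All (P ∘ key) ys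
      All-keys {P} keys≡ pxs = All.map⁻ (subst (All P) keys≡ (All.map⁺ pxs))

      foldl-moveFront : ∀ cs x bs s → All (λ c → key c ≡ key x) cs →
                        foldl step s (cs ++ x ∷ bs) ≗ foldl step s (x ∷ cs ++ bs)
      foldl-moveFront []       x bs s _             = ≗.refl
      foldl-moveFront (c ∷ cs) x bs s (c≡x ∷ cs≡x) =
        ≗.trans (foldl-moveFront cs x bs (step s c) cs≡x) (foldl-cong (step-comm s c x (key⇒val c x c≡x)) (cs ++ bs))

      map-key-moveFront : ∀ cs x bs → All (λ c → key c ≡ key x) cs → map key (cs ++ x ∷ bs) ≡ key x ∷ map key (cs ++ bs)
      map-key-moveFront []       x bs _             = refl
      map-key-moveFront (c ∷ cs) x bs (c≡x ∷ cs≡x) =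
        cong₂ _∷_ c≡x (trans (map-key-moveFront cs x bs cs≡x) (cong (_∷ map key (cs ++ bs)) (sym c≡x)))

      below? : ∀ M z → Dec (key z < M)
      below? M z = key z <? M

      ∈-below : ∀ M {x xs ys} → key x < M → filter (below? M) (x ∷ xs) ↭ filter (below? M) ys → x ∈ ys
      ∈-below M {x} x<M below↭ =
        proj₁ (∈-filter⁻ (below? M) (↭.∈-resp-↭ below↭ (subst (x ∈_) (sym (filter-accept (below? M) x<M)) (here refl))))

      -- The steps with key below the top key M agree up to equal-key reorderings; those with key M only fill.
      foldl-reorder : ∀ M xs ys s → Sorted xs → Sorted ys → map key xs ≡ map key ys → All (λ z → key z ≤ M) xs →
                      filter (below? M) xs ↭ filter (below? M) ys →
                      freeCount s ≡ length xs → foldl step s xs ≗ foldl step s ys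
      foldl-reorder M [] [] s _ _ _ _ _ _ = ≗.refl
      foldl-reorder M (x ∷ xs) ys s (x≤xs ∷ sxs) sys keys≡ (x≤M ∷ xs≤M) below↭ fc≡ with key x <? M
      ... | no x≮M = ≗.trans (foldl-fill (x ∷ xs) s (val x) fc≡ (All.map (key⇒val _ x ∘ top≡) top))
                       (≗.sym (foldl-fill ys s (val x) (trans fc≡ lengths≡)
                                (All.map (key⇒val _ x ∘ top≡) (All-keys {λ k → k ≡ M} keys≡ top))))
        where
        x≡M : key x ≡ M
        x≡M = ≤-antisym x≤M (≮⇒≥ x≮M)
        top : All (λ z → key z ≡ M) (x ∷ xs)
        top = x≡M ∷ All.zipWith (λ (x≤z , z≤M) → ≤-antisym z≤M (subst (_≤ _) x≡M x≤z)) (x≤xs , xs≤M)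
        top≡ : ∀ {z} → key z ≡ M → key z ≡ key x
        top≡ z≡M = trans z≡M (sym x≡M)
        lengths≡ : length (x ∷ xs) ≡ length ys
        lengths≡ = trans (sym (length-map key (x ∷ xs))) (trans (cong length keys≡) (length-map key ys))
      ... | yes x<M with as , bs , refl ← ∈-∃++ (∈-below M {x} {xs} {ys} x<M below↭) =
        ≗.trans (foldl-reorder M xs (as ++ bs) (step s x) sxs (AllPairs-dropMiddle as sys) keys′ xs≤M below′
                                 (step-freeCount s x fc≡))
                (≗.sym (foldl-moveFront as x bs s as≡x))
        where
        as≡x : All (λ c → key c ≡ key x) as
        as≡x = All.zipWith (λ (x≤c , c≤) → ≤-antisym (All.head c≤) x≤c)
                 (All.++⁻ˡ as (All-keys {key x ≤_} keys≡ (≤-refl ∷ x≤xs)) , AllPairs-++⇒All-All as sys)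
        keys′ : map key xs ≡ map key (as ++ bs)
        keys′ = ∷-injectiveʳ (trans keys≡ (map-key-moveFront as x bs as≡x))
        below′ : filter (below? M) xs ↭ filter (below? M) (as ++ bs)
        below′ = ↭.drop-∷ (begin
          x ∷ filter (below? M) xs                         ≡⟨ filter-accept (below? M) x<M ⟨
          filter (below? M) (x ∷ xs)                       ↭⟨ below↭ ⟩
          filter (below? M) (as ++ x ∷ bs)                 ≡⟨ filter-++ (below? M) as (x ∷ bs) ⟩
          filter (below? M) as ++ filter (below? M) (x ∷ bs) ≡⟨ cong (filter (below? M) as ++_) (filter-accept (below? M) x<M) ⟩
          filter (below? M) as ++ x ∷ filter (below? M) bs ↭⟨ ↭.shift x (filter (below? M) as) (filter (below? M) bs) ⟩
          x ∷ filter (below? M) as ++ filter (below? M) bs ≡⟨ cong (x ∷_) (filter-++ (below? M) as bs) ⟨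
          x ∷ filter (below? M) (as ++ bs)                 ∎)
          where open PermutationReasoning

      foldl-prefix : ∀ xs₁ zs₁ xs₂ zs₂ s → xs₁ ++ zs₁ ↭ xs₂ ++ zs₂ → Sorted xs₁ → Sorted xs₂ →
                     map key xs₁ ≡ map key xs₂ →
                     All (λ x → All (λ z → key x ≤ key z) zs₁) xs₁ → All (λ x → All (λ z → key x ≤ key z) zs₂) xs₂ →
                     freeCount s ≡ length xs₁ → foldl step s xs₁ ≗ foldl step s xs₂
      foldl-prefix xs₁ zs₁ xs₂ zs₂ s perm sxs₁ sxs₂ keys≡ xs₁≤zs₁ xs₂≤zs₂ =
        foldl-reorder M xs₁ xs₂ s sxs₁ sxs₂ keys≡ (All.map⁻ (xs≤max 0 (map key xs₁)))
          (subst₂ _↭_ (below-++ xs₁ zs₁ (M≤ xs₁ xs₁≤zs₁))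
                      (below-++ xs₂ zs₂ (subst (λ m → All (λ z → m ≤ key z) zs₂) (cong (max 0) (sym keys≡))
                                                (M≤ xs₂ xs₂≤zs₂)))
                      (↭.filter-↭ (below? M) perm))
        where
        M = max 0 (map key xs₁)
        M≤ : ∀ xs {zs} → All (λ x → All (λ z → key x ≤ key z) zs) xs → All (λ z → max 0 (map key xs) ≤ key z) zs
        M≤ xs xs≤zs = All.map (λ ≤z → max≤v⁺ z≤n (All.map⁺ ≤z)) (All.All-swap xs≤zs)
        below-++ : ∀ xs zs → All (λ z → M ≤ key z) zs → filter (below? M) (xs ++ zs) ≡ filter (below? M) xs
        below-++ xs zs M≤zs = trans (filter-++ (below? M) xs zs)
          (trans (cong (filter (below? M) xs ++_) (filter-none (below? M) (All.map (λ M≤z z<M → <⇒≱ z<M M≤z) M≤zs)))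
                 (++-identityʳ (filter (below? M) xs)))

    AgreeOn : State → State → Set
    AgreeOn s t = ∀ j → ok j ≡ true → s j ≡ t j

    free-agree : ∀ {s t} → AgreeOn s t → free ok s ≗ free ok t
    free-agree {s} {t} s≈t j with ok j in okj
    ... | true  = cong isUnset (s≈t j okj)
    ... | false = refl

    step-agree : ∀ {s t} → AgreeOn s t → ∀ a → AgreeOn (step s a) (step t a)
    step-agree {s} {t} s≈t a j okj with view s a
    ... | blocked none s≗ =
      trans (s≗ j) (trans (s≈t j okj) (sym (step-blocked (λ i → trans (sym (free-agree s≈t i)) (none i)) j)))
    ... | fills d nearest s≗ = trans (s≗ j) (trans (setAt-agree (d F.≟ j)) (sym (step-nearest (Nearest-cong S (free-agree s≈t) nearest) j)))
      where
      setAt-agree : Dec (d ≡ j) → setAt s d (val a) j ≡ setAt t d (val a) j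
      setAt-agree (yes refl) = trans (setAt-≡ s d (val a)) (sym (setAt-≡ t d (val a)))
      setAt-agree (no d≢j)   = trans (setAt-≢ s d (val a) d≢j) (trans (s≈t j okj) (sym (setAt-≢ t d (val a) d≢j)))

    foldl-agree : ∀ {s t} → AgreeOn s t → ∀ xs → AgreeOn (foldl step s xs) (foldl step t xs)
    foldl-agree s≈t []       = s≈t
    foldl-agree s≈t (a ∷ xs) = foldl-agree (step-agree s≈t a) xs

    step-outside : ∀ s a j → ok j ≡ false → step s a j ≡ s j
    step-outside s a j okj with view s a
    ... | blocked _ s≗ = s≗ j
    ... | fills d (fd , _) s≗ = trans (s≗ j) (setAt-≢ s d (val a) d≢j)
      where
      d≢j : d ≢ j
      d≢j refl with () ← trans (sym fd) (cong (_∧ isUnset (s d)) okj)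

    foldl-outside : ∀ s xs j → ok j ≡ false → foldl step s xs j ≡ s j
    foldl-outside s []       j okj = refl
    foldl-outside s (a ∷ xs) j okj = trans (foldl-outside (step s a) xs j okj) (step-outside s a j okj)

    Bounded : ℕ → State → Set
    Bounded V s = ∀ j {x} → s j ≡ just x → x ≤ V

    foldl-bounded : ∀ {V} → (∀ a → val a ≤ V) → ∀ s xs → Bounded V s → Bounded V (foldl step s xs)
    foldl-bounded val≤ s []       s≤ = s≤
    foldl-bounded {V} val≤ s (a ∷ xs) s≤ = foldl-bounded val≤ (step s a) xs sa≤
      where
      sa≤ : Bounded V (step s a)
      sa≤ j sa≡ with view s a
      ... | blocked _ s≗ = s≤ j (trans (sym (s≗ j)) sa≡)
      ... | fills d _ s≗ with d F.≟ j
      ...   | yes refl = subst (_≤ V) (just-injective (trans (sym (setAt-≡ s d (val a))) (trans (sym (s≗ d)) sa≡))) (val≤ a)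
      ...   | no d≢j   = s≤ j (trans (sym (setAt-≢ s d (val a) d≢j)) (trans (sym (s≗ j)) sa≡))

  mirror : (ℕ → ℕ) → State → State
  mirror g s j = Maybe.map g (s (opposite j))

  mirror-cong : ∀ g {s t} → s ≗ t → mirror g s ≗ mirror g t
  mirror-cong g s≗t j = cong (Maybe.map g) (s≗t (opposite j))

  module Mirroring (S₁ : SearchOrder) (ok₁ : Fin n → Bool) (val₁ : Fin n → ℕ)
                   (S₂ : SearchOrder) (ok₂ : Fin n → Bool) (val₂ : Fin n → ℕ) (g : ℕ → ℕ)
                   (ok-opposite : ∀ j → ok₂ j ≡ ok₁ (opposite j))
                   (val-opposite : ∀ a → val₂ (opposite a) ≡ g (val₁ a))
                   (distance-opposite : ∀ a j → distance S₂ (opposite a) (opposite j) ≡ distance S₁ a j) where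
    module M₁ = Steps S₁ ok₁ val₁
    module M₂ = Steps S₂ ok₂ val₂

    free-mirror : ∀ {w} s → w ≗ mirror g s → ∀ j → free ok₂ w j ≡ free ok₁ s (opposite j)
    free-mirror {w} s w≗ j = cong₂ _∧_ (ok-opposite j) (trans (cong isUnset (w≗ j)) (isUnset-map (s (opposite j))))
      where
      isUnset-map : ∀ m → isUnset (Maybe.map g m) ≡ isUnset m
      isUnset-map nothing  = refl
      isUnset-map (just _) = refl

    Nearest-mirror : ∀ {w} s {a d} → w ≗ mirror g s →
                     Nearest S₁ (free ok₁ s) a d → Nearest S₂ (free ok₂ w) (opposite a) (opposite d)
    Nearest-mirror {w} s {a} {d} w≗ (fd , d≤) =
      trans (free-mirror s w≗ (opposite d)) (trans (cong (free ok₁ s) (opposite-involutive d)) fd) ,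
      λ j fj → subst₂ _≤_ (sym (distance-opposite a d))
                          (trans (sym (distance-opposite a (opposite j))) (cong (distance S₂ (opposite a)) (opposite-involutive j)))
                          (d≤ (opposite j) (trans (sym (free-mirror s w≗ j)) fj))

    setAt-mirror : ∀ s d x → setAt (mirror g s) (opposite d) (g x) ≗ mirror g (setAt s d x)
    setAt-mirror s d x k with opposite d F.≟ k
    ... | yes refl = cong (Maybe.map g) (sym (trans (cong (setAt s d x) (opposite-involutive d)) (setAt-≡ s d x)))
    ... | no d≢k   = cong (Maybe.map g) (sym (setAt-≢ s d x λ { refl → d≢k (opposite-involutive k) }))

    step-mirror : ∀ {w s} → w ≗ mirror g s → ∀ a → M₂.step w (opposite a) ≗ mirror g (M₁.step s a)
    step-mirror {w} {s} w≗ a with M₁.view s a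
    ... | M₁.blocked none s≗ =
      ≗.trans (M₂.step-blocked (λ j → trans (free-mirror s w≗ j) (none (opposite j)))) (≗.trans w≗ (mirror-cong g (≗.sym s≗)))
    ... | M₁.fills d nearest s≗ = begin
      M₂.step w (opposite a)                          ≈⟨ M₂.step-nearest (Nearest-mirror s w≗ nearest) ⟩
      setAt w (opposite d) (val₂ (opposite a))        ≈⟨ setAt-cong w≗ (opposite d) _ ⟩
      setAt (mirror g s) (opposite d) (val₂ (opposite a)) ≈⟨ setAt-val (mirror g s) (opposite d) (val-opposite a) ⟩
      setAt (mirror g s) (opposite d) (g (val₁ a))    ≈⟨ setAt-mirror s d (val₁ a) ⟩
      mirror g (setAt s d (val₁ a))                   ≈⟨ mirror-cong g s≗ ⟨
      mirror g (M₁.step s a)                          ∎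
      where open ≈-Reasoning (Fin n →-setoid Maybe ℕ)

    foldl-mirror : ∀ {w s} → w ≗ mirror g s → ∀ xs → foldl M₂.step w (map opposite xs) ≗ mirror g (foldl M₁.step s xs)
    foldl-mirror w≗ []       = w≗
    foldl-mirror w≗ (a ∷ xs) = foldl-mirror (step-mirror w≗ a) xs

module Queues (n : ℕ) .{{_ : NonZero n}} where
  open Searching n
  open Placing n

  SortedBy : Word n → List (Fin n) → Set
  SortedBy u = AllPairs (λ a b → u a ≤ u b)

  module Queue (q : Subset n) (u : Word n) where
    k : ℕ
    k = ∣ q ∣

    module I  = Steps leftSearch  (not ∘ isIn q) (λ i → u i + 1)
    module II = Steps rightSearch (isIn q) u

    phaseI phaseII : List (Fin n) → List (Fin n)
    phaseI  o = reverse (drop k o)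
    phaseII o = take k o

    afterI afterII : List (Fin n) → State
    afterI  o = foldl I.step empty (phaseI o)
    afterII o = foldl II.step (afterI o) (phaseII o)

    run : List (Fin n) → Word n
    run o i = fromMaybe 0 (afterII o i)

    afterII-inside : ∀ o j → isIn q j ≡ true → afterII o j ≡ foldl II.step empty (phaseII o) j
    afterII-inside o = II.foldl-agree (λ j j∈q → I.foldl-outside empty (phaseI o) j (cong not j∈q)) (phaseII o)

    afterII-outside : ∀ o j → isIn q j ≡ false → afterII o j ≡ afterI o j
    afterII-outside o j = II.foldl-outside (afterI o) (phaseII o) j

    freeCountII : II.freeCount empty ≡ k
    freeCountII = trans (count-cong (λ j → ∧-identityʳ (isIn q j))) (count-lookup q)

    freeCountI : I.freeCount empty ≡ n ∸ k
    freeCountI = trans (count-cong (λ j → ∧-identityʳ (not (isIn q j)))) (count-not-lookup q)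

    module _ {o : List (Fin n)} (o-length : length o ≡ n) where

      length-phaseII : length (phaseII o) ≡ k
      length-phaseII = trans (length-take k o) (trans (cong (k ⊓_) o-length) (m≤n⇒m⊓n≡m (∣p∣≤n q)))

      length-phaseI : length (phaseI o) ≡ n ∸ k
      length-phaseI = trans (length-reverse (drop k o)) (trans (length-drop k o) (cong (_∸ k) o-length))

      afterII-filled : ∀ {V} → (∀ i → u i + 1 ≤ V) → ∀ j → ∃ λ x → afterII o j ≡ just x × x ≤ V
      afterII-filled {V} u<V j with isIn q j in j∈q
      ... | true
        with x , eq ← occupied (isIn q) (foldl II.step empty (phaseII o)) j∈q
                         (II.foldl-exhausts empty (phaseII o) (trans freeCountII (sym length-phaseII)) j)
        = x , trans (afterII-inside o j j∈q) eq ,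
          II.foldl-bounded (λ a → ≤-trans (m≤m+n (u a) 1) (u<V a)) empty (phaseII o) (λ _ ()) j eq
      ... | false
        with x , eq ← occupied (not ∘ isIn q) (afterI o) (cong not j∈q)
                         (I.foldl-exhausts empty (phaseI o) (trans freeCountI (sym length-phaseI)) j)
        = x , trans (afterII-outside o j j∈q) eq , I.foldl-bounded u<V empty (phaseI o) (λ _ ()) j eq

    module _ {o₁ o₂ : List (Fin n)} (o₁↭o₂ : o₁ ↭ o₂) (sorted₁ : SortedBy u o₁) (sorted₂ : SortedBy u o₂) where

      values≡ : map u o₁ ≡ map u o₂
      values≡ = sorted-↭⇒≡ (AllPairs.map⁺ sorted₁) (AllPairs.map⁺ sorted₂) (↭.map⁺ u o₁↭o₂)

      split-sorted : ∀ {o} → SortedBy u o → All (λ a → All (λ b → u a ≤ u b) (drop k o)) (take k o)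
      split-sorted {o} sorted = AllPairs-++⇒All-All (take k o) (subst (SortedBy u) (sym (take++drop≡id k o)) sorted)

      phaseII-independent : length o₁ ≡ n → foldl II.step empty (phaseII o₁) ≗ foldl II.step empty (phaseII o₂)
      phaseII-independent o₁-length = Reordering.foldl-prefix u (λ _ _ → id)
        (phaseII o₁) (drop k o₁) (phaseII o₂) (drop k o₂) empty
        (subst₂ _↭_ (sym (take++drop≡id k o₁)) (sym (take++drop≡id k o₂)) o₁↭o₂)
        (AllPairs.take⁺ k sorted₁) (AllPairs.take⁺ k sorted₂)
        (trans (sym (take-map k o₁)) (trans (cong (take k) values≡) (take-map k o₂)))
        (split-sorted sorted₁) (split-sorted sorted₂)
        (trans freeCountII (sym (length-phaseII o₁-length)))
        where open II

      module _ {B : ℕ} (u≤B : ∀ i → u i ≤ B) where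
        open I

        -- Phase I runs through the letters in decreasing order, i.e. increasingly for this key.
        key : Fin n → ℕ
        key a = B ∸ u a

        key⇒val : ∀ a b → key a ≡ key b → u a + 1 ≡ u b + 1
        key⇒val a b eq = cong (_+ 1) (∸-cancelˡ-≡ (u≤B a) (u≤B b) eq)

        phaseI++phaseII : ∀ o → phaseI o ++ phaseII o ↭ o
        phaseI++phaseII o = ↭-trans (↭.++⁺ʳ (take k o) (↭.↭-reverse (drop k o)))
          (↭-trans (↭.++-comm (drop k o) (take k o)) (subst (_↭ o) (sym (take++drop≡id k o)) ↭-refl))

        keys-phaseI : ∀ o → map key (phaseI o) ≡ reverse (drop k (map (B ∸_) (map u o)))
        keys-phaseI o = trans (reverse-map key (drop k o)) (cong reverse (trans (sym (drop-map k o)) (cong (drop k) (map-∘ o))))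

        phaseI-sorted : ∀ {o} → SortedBy u o → SortedBy key (phaseI o)
        phaseI-sorted sorted = AllPairs.map (∸-monoʳ-≤ B) (AllPairs-reverse (AllPairs.drop⁺ k sorted))

        phaseI-below : ∀ {o} → SortedBy u o → All (λ a → All (λ b → key a ≤ key b) (phaseII o)) (phaseI o)
        phaseI-below sorted = All-reverse (All.map (All.map (∸-monoʳ-≤ B)) (All.All-swap (split-sorted sorted)))

        phaseI-independent : length o₁ ≡ n → afterI o₁ ≗ afterI o₂
        phaseI-independent o₁-length = Reordering.foldl-prefix key key⇒val
          (phaseI o₁) (phaseII o₁) (phaseI o₂) (phaseII o₂) empty
          (↭-trans (phaseI++phaseII o₁) (↭-trans o₁↭o₂ (↭-sym (phaseI++phaseII o₂))))
          (phaseI-sorted sorted₁) (phaseI-sorted sorted₂)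
          (trans (keys-phaseI o₁) (trans (cong (λ vs → reverse (drop k (map (B ∸_) vs))) values≡) (sym (keys-phaseI o₂))))
          (phaseI-below sorted₁) (phaseI-below sorted₂)
          (trans freeCountI (sym (length-phaseI o₁-length)))

        run-independent : length o₁ ≡ n → run o₁ ≗ run o₂
        run-independent o₁-length j with isIn q j in j∈q
        ... | true  = cong (fromMaybe 0) (trans (afterII-inside o₁ j j∈q)
                        (trans (phaseII-independent o₁-length j) (sym (afterII-inside o₂ j j∈q))))
        ... | false = cong (fromMaybe 0) (trans (afterII-outside o₁ j j∈q)
                        (trans (phaseI-independent o₁-length j) (sym (afterII-outside o₂ j j∈q))))

  order : Permutation′ n → List (Fin n)
  order π = map (π ⟨$⟩ʳ_) (allFin n)

  order-length : ∀ π → length (order π) ≡ n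
  order-length π = trans (length-map (π ⟨$⟩ʳ_) (allFin n)) (length-tabulate id)

  order-sorted : ∀ u π → IsSorting u π → SortedBy u (order π)
  order-sorted u π sorting = subst (SortedBy u) (sym (map-tabulate id (π ⟨$⟩ʳ_)))
    (AllPairs.tabulate⁺-< (λ i<j → sorting _ _ (<⇒≤ i<j)))

  ListsAllSites : List (Fin n) → Set
  ListsAllSites o = Unique o × (∀ j → j ∈ o)

  ListsAllSites⇒↭ : ∀ {o o′} → ListsAllSites o → ListsAllSites o′ → o ↭ o′
  ListsAllSites⇒↭ (unique , complete) (unique′ , complete′) = ∼bag⇒↭ (unique∧set⇒bag unique unique′
    λ {j} → mk⇔ (λ _ → complete′ j) (λ _ → complete j))

  order-ListsAllSites : ∀ π → ListsAllSites (order π)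
  order-ListsAllSites π =
    Unique.map⁺ (λ {i} {j} eq → trans (sym (inverseˡ π)) (trans (cong (π ⟨$⟩ˡ_) eq) (inverseˡ π))) (Unique.allFin⁺ n) ,
    λ j → subst (_∈ order π) (inverseʳ π) (∈-map⁺ (π ⟨$⟩ʳ_) (∈-allFin (π ⟨$⟩ˡ j)))

  dualOrder : List (Fin n) → List (Fin n)
  dualOrder o = map opposite (reverse o)

  dualOrder-ListsAllSites : ∀ {o} → ListsAllSites o → ListsAllSites (dualOrder o)
  dualOrder-ListsAllSites {o} (unique , complete) =
    Unique.map⁺ (λ {i} {j} eq → trans (sym (opposite-involutive i)) (trans (cong opposite eq) (opposite-involutive j)))
      (AllPairs.map (_∘ sym) (AllPairs-reverse unique)) ,
    λ j → subst (_∈ dualOrder o) (opposite-involutive j) (∈-map⁺ opposite (Any.reverse⁺ (complete (opposite j))))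

  dualOrder-sorted : ∀ ℓ u {o} → SortedBy u o → SortedBy (dualWord ℓ u) (dualOrder o)
  dualOrder-sorted ℓ u sorted = AllPairs.map⁺ (AllPairs.map dual≤ (AllPairs-reverse sorted))
    where
    dual≤ : ∀ {a b} → u b ≤ u a → dualWord ℓ u (opposite a) ≤ dualWord ℓ u (opposite b)
    dual≤ {a} {b} ub≤ua rewrite opposite-involutive a | opposite-involutive b = ∸-monoʳ-≤ (ℓ + 1) ub≤ua

  module Duality (q : Subset n) (u : Word n) (ℓ : ℕ) (u≤ℓ : ∀ i → u i ≤ ℓ) where
    module Q  = Queue q u
    module Q* = Queue (dualQueue q) (dualWord ℓ u)

    u+1≤ℓ+2 : ∀ a → u a + 1 ≤ ℓ + 2
    u+1≤ℓ+2 a = +-mono-≤ (u≤ℓ a) (s≤s z≤n)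

    dualWord-opposite : ∀ a → dualWord ℓ u (opposite a) ≡ ℓ + 2 ∸ (u a + 1)
    dualWord-opposite a = trans (cong (λ z → ℓ + 1 ∸ u z) (opposite-involutive a))
                                (sym (cong₂ _∸_ (+-suc ℓ 1) (+-comm (u a) 1)))

    dualWord-opposite+1 : ∀ a → dualWord ℓ u (opposite a) + 1 ≡ ℓ + 2 ∸ u a
    dualWord-opposite+1 a = trans (cong (λ z → ℓ + 1 ∸ u z + 1) (opposite-involutive a))
      (trans (sym (+-∸-comm 1 (≤-trans (u≤ℓ a) (m≤m+n ℓ 1)))) (cong (_∸ u a) (+-assoc ℓ 1 1)))

    isIn-dualQueue : ∀ j → isIn (dualQueue q) j ≡ not (isIn q (opposite j))
    isIn-dualQueue = lookup∘tabulate (λ i → not (lookup q (opposite i)))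

    ∣dualQueue∣ : ∣ dualQueue q ∣ ≡ n ∸ Q.k
    ∣dualQueue∣ = begin
      ∣ dualQueue q ∣                   ≡⟨ count-lookup (dualQueue q) ⟨
      count (isIn (dualQueue q))        ≡⟨ count-cong isIn-dualQueue ⟩
      count (not ∘ isIn q ∘ opposite)   ≡⟨ count-opposite (not ∘ isIn q) ⟩
      count (not ∘ isIn q)              ≡⟨ count-not-lookup q ⟩
      n ∸ Q.k                          ∎
      where open ≡-Reasoning

    module _ {o : List (Fin n)} (o-length : length o ≡ n) where

      dualOrder-split : dualOrder o ≡ map opposite (Q.phaseI o) ++ map opposite (reverse (Q.phaseII o))
      dualOrder-split = trans (cong dualOrder (sym (take++drop≡id Q.k o)))
        (trans (cong (map opposite) (reverse-++ (take Q.k o) (drop Q.k o))) (map-++ opposite (Q.phaseI o) _))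

      ∣dualQueue∣≡length : ∣ dualQueue q ∣ ≡ length (map opposite (Q.phaseI o))
      ∣dualQueue∣≡length = trans ∣dualQueue∣ (sym (trans (length-map opposite (Q.phaseI o)) (Q.length-phaseI o-length)))

      phaseII-dualOrder : Q*.phaseII (dualOrder o) ≡ map opposite (Q.phaseI o)
      phaseII-dualOrder = trans (cong₂ take ∣dualQueue∣≡length dualOrder-split)
        (take-length-++ (map opposite (Q.phaseI o)) (map opposite (reverse (Q.phaseII o))))

      phaseI-dualOrder : Q*.phaseI (dualOrder o) ≡ map opposite (Q.phaseII o)
      phaseI-dualOrder = begin
        reverse (drop ∣ dualQueue q ∣ (dualOrder o))       ≡⟨ cong reverse (cong₂ drop ∣dualQueue∣≡length dualOrder-split) ⟩
        reverse (drop (length mirroredI) (mirroredI ++ mirroredII)) ≡⟨ cong reverse (drop-length-++ mirroredI mirroredII) ⟩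
        reverse (map opposite (reverse (Q.phaseII o)))     ≡⟨ reverse-map opposite (reverse (Q.phaseII o)) ⟨
        map opposite (reverse (reverse (Q.phaseII o)))     ≡⟨ cong (map opposite) (reverse-involutive (Q.phaseII o)) ⟩
        map opposite (Q.phaseII o)                         ∎
        where
        open ≡-Reasoning
        mirroredI mirroredII : List (Fin n)
        mirroredI  = map opposite (Q.phaseI o)
        mirroredII = map opposite (reverse (Q.phaseII o))

      afterII-dualOrder : Q*.afterII (dualOrder o) ≗ mirror (ℓ + 2 ∸_) (Q.afterII o)
      afterII-dualOrder j with isIn q (opposite j) in q[ōj]
      ... | false = begin
        Q*.afterII (dualOrder o) j                                  ≡⟨ Q*.afterII-inside (dualOrder o) j q*∋j ⟩
        foldl Q*.II.step empty (Q*.phaseII (dualOrder o)) j         ≡⟨ cong (λ xs → foldl Q*.II.step empty xs j) phaseII-dualOrder ⟩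
        foldl Q*.II.step empty (map opposite (Q.phaseI o)) j        ≡⟨ M.foldl-mirror (λ _ → refl) (Q.phaseI o) j ⟩
        mirror (ℓ + 2 ∸_) (Q.afterI o) j                            ≡⟨ cong (Maybe.map (ℓ + 2 ∸_)) (Q.afterII-outside o (opposite j) q[ōj]) ⟨
        mirror (ℓ + 2 ∸_) (Q.afterII o) j                           ∎
        where
        open ≡-Reasoning
        q*∋j : isIn (dualQueue q) j ≡ true
        q*∋j = trans (isIn-dualQueue j) (cong not q[ōj])
        module M = Mirroring leftSearch (not ∘ isIn q) (λ i → u i + 1)
                             rightSearch (isIn (dualQueue q)) (dualWord ℓ u) (ℓ + 2 ∸_)
          isIn-dualQueue
          dualWord-opposite right-distance-opposite
      ... | true = begin
        Q*.afterII (dualOrder o) j                                  ≡⟨ Q*.afterII-outside (dualOrder o) j q*∌j ⟩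
        foldl Q*.I.step empty (Q*.phaseI (dualOrder o)) j           ≡⟨ cong (λ xs → foldl Q*.I.step empty xs j) phaseI-dualOrder ⟩
        foldl Q*.I.step empty (map opposite (Q.phaseII o)) j        ≡⟨ M.foldl-mirror (λ _ → refl) (Q.phaseII o) j ⟩
        mirror (ℓ + 2 ∸_) (foldl Q.II.step empty (Q.phaseII o)) j   ≡⟨ cong (Maybe.map (ℓ + 2 ∸_)) (Q.afterII-inside o (opposite j) q[ōj]) ⟨
        mirror (ℓ + 2 ∸_) (Q.afterII o) j                           ∎
        where
        open ≡-Reasoning
        q*∌j : isIn (dualQueue q) j ≡ false
        q*∌j = trans (isIn-dualQueue j) (cong not q[ōj])
        module M = Mirroring rightSearch (isIn q) u
                             leftSearch (not ∘ isIn (dualQueue q)) (λ i → dualWord ℓ u i + 1) (ℓ + 2 ∸_)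
          (λ j → trans (cong not (isIn-dualQueue j)) (not-involutive _))
          dualWord-opposite+1 left-distance-opposite

      run-dualOrder : ∀ i → Q.run o i ≡ ℓ + 2 ∸ Q*.run (dualOrder o) (opposite i)
      run-dualOrder i with x , filled , x≤ ← Q.afterII-filled o-length u+1≤ℓ+2 i = begin
        Q.run o i                                                  ≡⟨ cong (fromMaybe 0) filled ⟩
        x                                                          ≡⟨ m∸[m∸n]≡n x≤ ⟨
        ℓ + 2 ∸ (ℓ + 2 ∸ x)                                        ≡⟨ cong (λ m → ℓ + 2 ∸ fromMaybe 0 (Maybe.map (ℓ + 2 ∸_) m))
                                                                           (trans (cong (Q.afterII o) (opposite-involutive i)) filled) ⟨
        ℓ + 2 ∸ fromMaybe 0 (mirror (ℓ + 2 ∸_) (Q.afterII o) (opposite i)) ≡⟨ cong (λ m → ℓ + 2 ∸ fromMaybe 0 m)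
                                                                                 (afterII-dualOrder (opposite i)) ⟨
        ℓ + 2 ∸ Q*.run (dualOrder o) (opposite i)                  ∎
        where open ≡-Reasoning

u≤classes : ∀ {n} (u : Word n) i → u i ≤ classes u
u≤classes {n} u i = ≤-foldr (allFin n) (∈-allFin i)
  where
  ≤-foldr : ∀ xs → i ∈ xs → u i ≤ foldr (λ j acc → u j ⊔ acc) 0 xs
  ≤-foldr (j ∷ xs) (here refl)  = m≤m⊔n (u j) _
  ≤-foldr (j ∷ xs) (there i∈xs) = ≤-trans (≤-foldr xs i∈xs) (m≤n⊔m (u j) _)

lemma2p6 : (n : ℕ) .{{_ : NonZero n}} (q : Subset n) (u : Word n) (ℓ : ℕ) →
    Positive u → classes u ≡ ℓ →
    (σ : Permutation′ n) → IsSorting u σ →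
    (τ : Permutation′ n) → IsSorting (dualWord ℓ u) τ →
    (i : Fin n) →
    queueOp q u σ i ≡ ℓ + 2 ∸ queueOp (dualQueue q) (dualWord ℓ u) τ (opposite i)
lemma2p6 n q u ℓ _ classes≡ℓ σ σ-sorts τ τ-sorts i = begin
  queueOp q u σ i                                              ≡⟨ run-dualOrder (order-length σ) i ⟩
  ℓ + 2 ∸ Q*.run (dualOrder (order σ)) (opposite i)            ≡⟨ cong (ℓ + 2 ∸_) (dual-orders-agree (opposite i)) ⟨
  ℓ + 2 ∸ queueOp (dualQueue q) (dualWord ℓ u) τ (opposite i)  ∎
  where
  open ≡-Reasoning
  open Queues n
  open Duality q u ℓ (λ j → subst (u j ≤_) classes≡ℓ (u≤classes u j))
  τ-order↭ : order τ ↭ dualOrder (order σ)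
  τ-order↭ = ListsAllSites⇒↭ (order-ListsAllSites τ) (dualOrder-ListsAllSites (order-ListsAllSites σ))
  dual-orders-agree : Q*.run (order τ) ≗ Q*.run (dualOrder (order σ))
  dual-orders-agree = Q*.run-independent τ-order↭
    (order-sorted (dualWord ℓ u) τ τ-sorts) (dualOrder-sorted ℓ u (order-sorted u σ σ-sorts))
    (λ j → m∸n≤m (ℓ + 1) (u (opposite j))) (order-length τ)
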